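{- Let $m,n\ge1$, let $\Phi^1\le\Gamma^1$, $\Phi^2\le\Gamma^2$ be integer-valued $m\times n$ matrices (entries of $\Phi^1,\Phi^2$ may be $-\infty$, of $\Gamma^1,\Gamma^2$ may be $+\infty$), let $f\le g$ be integer-valued functions on $S_{m,n}$ ($f$ may take $-\infty$, $g$ may take $+\infty$), and let $\alpha\le\beta$ be in $\mathbb{Z}\cup\{\pm\infty\}$. Let $D$ be the digraph with vertices $v^1_{i,j},v^2_{i,j}$ for $(i,j)\in S_{m,n}$ and two further vertices $v^1_0,v^2_0$, and with arcs: $a^1_{i,j}=v^1_{i,j+1}v^1_{i,j}$ for $i\in[m]$, $j\in[n-1]$; $a^1_{i,n}=v^1_0v^1_{i,n}$ for $i\in[m]$; $a^2_{i,j}=v^2_{i,j}v^2_{i+1,j}$ for $i\in[m-1]$, $j\in[n]$; $a^2_{m,j}=v^2_{m,j}v^2_0$ for $j\in[n]$; $a_{i,j}=v^1_{i,j}v^2_{i,j}$ for $(i,j)\in S_{m,n}$; and $a_0=v^2_0v^1_0$. Define bounds $l,u$ on the arcs by $l(a^1_{i,j})=\Phi^1(i,j)$, $u(a^1_{i,j})=\Gamma^1(i,j)$, $l(a^2_{i,j})=\Phi^2(i,j)$, $u(a^2_{i,j})=\Gamma^2(i,j)$, $l(a_{i,j})=f(i,j)$, $u(a_{i,j})=g(i,j)$, $l(a_0)=\alpha$, $u(a_0)=\beta$. (A) If $z$ is an integer-valued circulation in $D$ with $l\le z\le u$, then the $m\times n$ matrix $M_z$ with $M_z(i,j):=z(a_{i,j})$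 is a prefix-bounded matrix (with respect to $\Phi^1,\Gamma^1,\Phi^2,\Gamma^2$) whose entries lie between $f$ and $g$ and whose total entry-sum lies between $\alpha$ and $\beta$. (B) Conversely, if $M$ is a prefix-bounded matrix whose entries lie between $f$ and $g$ and whose total entry-sum lies between $\alpha$ and $\beta$, then the function $z_M$ defined by $z_M(a^1_{i,j}):=M(i,1)+\dots+M(i,j)$, $z_M(a^2_{i,j}):=M(1,j)+\dots+M(i,j)$, $z_M(a_{i,j}):=M(i,j)$, $z_M(a_0):=\sum_{(i,j)\in S_{m,n}}M(i,j)$ is an integer-valued circulation in $D$ with $l\le z_M\le u$.
   Context: $S_{m,n}=[m]\times[n]$; matrices are functions on $S_{m,n}$ and $\tilde x(Z)=\sum_{s\in Z}x(s)$. $P^1_{i,j}=\{(i,1),\dots,(i,j)\}$, $P^2_{i,j}=\{(1,j),\dots,(i,j)\}$. A prefix-bounded matrix with respect to $\Phi^1,\Gamma^1,\Phi^2,\Gamma^2$ is an integer-valued $m\times n$ matrix $x$ with $\Phi^1(i,j)\le\tilde x(P^1_{i,j})\le\Gamma^1(i,j)$ and $\Phi^2(i,j)\le\tilde x(P^2_{i,j})\le\Gamma^2(i,j)$ for all $(i,j)$. A circulation in a digraph is a real function on the arcs such that at every vertex the total value of entering arcs equals the total value of leaving arcs. -}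

module Defs where

open import Data.Nat using (ℕ; zero; suc) renaming (_≤ᵇ_ to _≤ᵇℕ_)
open import Data.Integer using (ℤ; _+_; _≤_; 0ℤ)
open import Data.Fin using (Fin; zero; suc; toℕ)
open import Data.Fin.Properties using () renaming (_≟_ to _≟F_)
open import Data.Maybe using (Maybe; just; nothing)
import Data.Maybe as Maybe
open import Data.Bool using (Bool; true; false; if_then_else_; _∧_)
open import Data.Product using (_×_)
open import Relation.Nullary using (Dec; yes; no; does)
open import Relation.Binary.PropositionalEquality using (_≡_)

data ℤ∞ : Set where
  -∞  : ℤ∞
  fin : ℤ → ℤ∞
  +∞  : ℤ∞

data _≤∞_ : ℤ∞ → ℤ∞ → Set where
  -∞≤     : ∀ {a} → -∞ ≤∞ a
  ≤+∞     : ∀ {a} → a ≤∞ +∞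
  fin≤fin : ∀ {x y} → x ≤ y → fin x ≤∞ fin y

∑ : ∀ {n} → (Fin n → ℤ) → ℤ
∑ {zero}  f = 0ℤ
∑ {suc n} f = f zero + ∑ (λ k → f (suc k))

total : ∀ {m n} → (Fin m → Fin n → ℤ) → ℤ
total x = ∑ (λ i → ∑ (λ j → x i j))

rowPrefix : ∀ {m n} → (Fin m → Fin n → ℤ) → Fin m → Fin n → ℤ
rowPrefix x i j = ∑ (λ k → if toℕ k ≤ᵇℕ toℕ j then x i k else 0ℤ)

colPrefix : ∀ {m n} → (Fin m → Fin n → ℤ) → Fin m → Fin n → ℤ
colPrefix x i j = ∑ (λ k → if toℕ k ≤ᵇℕ toℕ i then x k j else 0ℤ)

PrefixBounded : ∀ {m n} → (Φ¹ Γ¹ Φ² Γ² : Fin m → Fin n → ℤ∞) →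
                (Fin m → Fin n → ℤ) → Set
PrefixBounded Φ¹ Γ¹ Φ² Γ² x = ∀ i j →
  (Φ¹ i j ≤∞ fin (rowPrefix x i j)) × (fin (rowPrefix x i j) ≤∞ Γ¹ i j) ×
  (Φ² i j ≤∞ fin (colPrefix x i j)) × (fin (colPrefix x i j) ≤∞ Γ² i j)

next : ∀ {n} → Fin n → Maybe (Fin n)
next {suc zero}    zero    = nothing
next {suc (suc n)} zero    = just (suc zero)
next {suc n}       (suc j) = Maybe.map suc (next j)

data Vertex (m n : ℕ) : Set where
  v¹  : Fin m → Fin n → Vertex m n
  v²  : Fin m → Fin n → Vertex m n
  v¹₀ : Vertex m n
  v²₀ : Vertex m n

_≟V_ : ∀ {m n} → (u v : Vertex m n) → Bool
v¹ i j ≟V v¹ i' j' = does (i ≟F i') ∧ does (j ≟F j')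
v² i j ≟V v² i' j' = does (i ≟F i') ∧ does (j ≟F j')
v¹₀    ≟V v¹₀      = true
v²₀    ≟V v²₀      = true
_      ≟V _        = false

data Arc (m n : ℕ) : Set where
  a¹ : Fin m → Fin n → Arc m n
  a² : Fin m → Fin n → Arc m n
  a  : Fin m → Fin n → Arc m n
  a₀ : Arc m n

-- tail (start) and head (end) of each arc;  arc uv goes from u to v
tail : ∀ {m n} → Arc m n → Vertex m n
tail (a¹ i j) with next j
... | just j' = v¹ i j'
... | nothing = v¹₀
tail (a² i j) = v² i j
tail (a i j)  = v¹ i j
tail a₀       = v²₀

head : ∀ {m n} → Arc m n → Vertex m n
head (a¹ i j) = v¹ i j
head (a² i j) with next i
... | just i' = v² i' j
... | nothing = v²₀
head (a i j)  = v² i j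
head a₀       = v¹₀

∑Arc : ∀ {m n} → (Arc m n → ℤ) → ℤ
∑Arc h = total (λ i j → h (a¹ i j)) + total (λ i j → h (a² i j))
       + total (λ i j → h (a i j)) + h a₀

inflow : ∀ {m n} → (Arc m n → ℤ) → Vertex m n → ℤ
inflow z v = ∑Arc (λ e → if head e ≟V v then z e else 0ℤ)

outflow : ∀ {m n} → (Arc m n → ℤ) → Vertex m n → ℤ
outflow z v = ∑Arc (λ e → if tail e ≟V v then z e else 0ℤ)

IsCirculation : ∀ {m n} → (Arc m n → ℤ) → Set
IsCirculation z = ∀ v → inflow z v ≡ outflow z v

lower : ∀ {m n} → (Φ¹ Φ² f : Fin m → Fin n → ℤ∞) → (α : ℤ∞) → Arc m n → ℤ∞
lower Φ¹ Φ² f α (a¹ i j) = Φ¹ i j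
lower Φ¹ Φ² f α (a² i j) = Φ² i j
lower Φ¹ Φ² f α (a i j)  = f i j
lower Φ¹ Φ² f α a₀       = α

upper : ∀ {m n} → (Γ¹ Γ² g : Fin m → Fin n → ℤ∞) → (β : ℤ∞) → Arc m n → ℤ∞
upper Γ¹ Γ² g β (a¹ i j) = Γ¹ i j
upper Γ¹ Γ² g β (a² i j) = Γ² i j
upper Γ¹ Γ² g β (a i j)  = g i j
upper Γ¹ Γ² g β a₀       = β

matrixOf : ∀ {m n} → (Arc m n → ℤ) → Fin m → Fin n → ℤ
matrixOf z i j = z (a i j)

circOf : ∀ {m n} → (Fin m → Fin n → ℤ) → Arc m n → ℤ
circOf M (a¹ i j) = rowPrefix M i j
circOf M (a² i j) = colPrefix M i j
circOf M (a i j)  = M i j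
circOf M a₀       = total M

-- Conservation at v¹_{i,j} reads z(a¹_{i,j}) = z(a¹_{i,j-1}) + z(a_{i,j}), and at v²_{i,j} it reads
-- z(a²_{i,j}) = z(a²_{i-1,j}) + z(a_{i,j}); these recurrences say exactly that z is the row prefix sums of
-- M_z on the a¹-arcs and its column prefix sums on the a²-arcs. Conservation at v¹_0 then makes z(a_0) the
-- sum of the last row prefixes, i.e. the total of M_z, and conservation at v²_0 holds because the last
-- column prefixes also add up to that total. So circulations and matrices correspond, and l ≤ z ≤ u is
-- literally the conjunction of the prefix bounds, the entry bounds and the bounds on the total.
module Submission where

open import Defs
open import Data.Nat using (ℕ; _≥_; zero; suc) renaming (_≤ᵇ_ to _≤ᵇℕ_)
open import Data.Integer using (ℤ; _+_; 0ℤ)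
open import Data.Integer.Properties using (+-identityˡ; +-identityʳ; +-assoc; +-0-commutativeMonoid)
open import Data.Fin using (Fin; zero; suc; toℕ; inject₁; fromℕ)
open import Data.Fin.Properties using (toℕ-inject₁) renaming (_≟_ to _≟F_)
open import Data.Fin.Induction using (<-weakInduction)
open import Data.Maybe using (Maybe; just; nothing; is-nothing)
import Data.Maybe as Maybe
open import Data.Bool using (Bool; true; false; if_then_else_; _∧_)
open import Data.Bool.Properties using (∧-zeroʳ)
open import Data.Product using (_×_; _,_; proj₁; proj₂)
open import Relation.Nullary using (does)
open import Relation.Binary.PropositionalEquality
open import Algebra.Properties.CommutativeMonoid.Sum +-0-commutativeMonoid
  using (sum; sum-cong-≗; sum-replicate-zero; ∑-comm)

_when_ : ℤ → Bool → ℤ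
x when b = if b then x else 0ℤ

∑≡sum : ∀ {N} (f : Fin N → ℤ) → ∑ f ≡ sum f
∑≡sum {zero}  f = refl
∑≡sum {suc N} f = cong (f zero +_) (∑≡sum (λ k → f (suc k)))

∑-cong : ∀ {N} {f g : Fin N → ℤ} → (∀ k → f k ≡ g k) → ∑ f ≡ ∑ g
∑-cong {f = f} {g} f≗g = trans (∑≡sum f) (trans (sum-cong-≗ f≗g) (sym (∑≡sum g)))

∑-zero : ∀ N → ∑ {N} (λ _ → 0ℤ) ≡ 0ℤ
∑-zero N = trans (∑≡sum {N} (λ _ → 0ℤ)) (sum-replicate-zero N)

∑-swap : ∀ {M N} (h : Fin M → Fin N → ℤ) → ∑ (λ i → ∑ (h i)) ≡ ∑ (λ j → ∑ (λ i → h i j))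
∑-swap h = begin
  ∑ (λ i → ∑ (h i))              ≡⟨ ∑-cong (λ i → ∑≡sum (h i)) ⟩
  ∑ (λ i → sum (h i))            ≡⟨ ∑≡sum (λ i → sum (h i)) ⟩
  sum (λ i → sum (h i))          ≡⟨ ∑-comm h ⟩
  sum (λ j → sum (λ i → h i j))  ≡⟨ ∑≡sum (λ j → sum (λ i → h i j)) ⟨
  ∑ (λ j → sum (λ i → h i j))    ≡⟨ ∑-cong (λ j → ∑≡sum (λ i → h i j)) ⟨
  ∑ (λ j → ∑ (λ i → h i j))      ∎
  where open ≡-Reasoning

∑-when-false : ∀ {N} (h : Fin N → ℤ) {b : Fin N → Bool} →
               (∀ k → b k ≡ false) → ∑ (λ k → h k when b k) ≡ 0ℤ
∑-when-false {N} h b≡false = trans (∑-cong (λ k → cong (h k when_) (b≡false k))) (∑-zero N)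

∑-when-≟ : ∀ {N} (h : Fin N → ℤ) (i : Fin N) → ∑ (λ k → h k when does (k ≟F i)) ≡ h i
∑-when-≟ {suc N} h zero    = trans (cong (h zero +_) (∑-zero N)) (+-identityʳ _)
∑-when-≟ {suc N} h (suc i) = trans (+-identityˡ _) (∑-when-≟ (λ k → h (suc k)) i)

∑-when-const : ∀ {N} (h : Fin N → ℤ) c → ∑ (λ k → h k when c) ≡ ∑ h when c
∑-when-const     h true  = refl
∑-when-const {N} h false = ∑-zero N

when-∧ : ∀ x c b → x when (c ∧ b) ≡ (x when b) when c
when-∧ x true  b = refl
when-∧ x false b = refl

∑-when-∧ : ∀ {N} (h : Fin N → ℤ) c (b : Fin N → Bool) →
           ∑ (λ k → h k when (c ∧ b k)) ≡ ∑ (λ k → h k when b k) when c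
∑-when-∧ h c b = trans (∑-cong (λ k → when-∧ (h k) c (b k))) (∑-when-const (λ k → h k when b k) c)

module _ {M N : ℕ} (h : Fin M → Fin N → ℤ) where

  total-when-cong : {P Q : Fin M → Fin N → Bool} → (∀ i j → P i j ≡ Q i j) →
    total (λ i j → h i j when P i j) ≡ total (λ i j → h i j when Q i j)
  total-when-cong P≡Q = ∑-cong (λ i → ∑-cong (λ j → cong (h i j when_) (P≡Q i j)))

  total-when-false : {P : Fin M → Fin N → Bool} → (∀ i j → P i j ≡ false) →
    total (λ i j → h i j when P i j) ≡ 0ℤ
  total-when-false P≡false = trans (∑-cong (λ i → ∑-when-false (h i) (P≡false i))) (∑-zero M)

  total-when-row : (i : Fin M) (b : Fin N → Bool) →
    total (λ i' j' → h i' j' when (does (i' ≟F i) ∧ b j')) ≡ ∑ (λ j' → h i j' when b j')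
  total-when-row i b = trans (∑-cong (λ i' → ∑-when-∧ (h i') (does (i' ≟F i)) b))
                             (∑-when-≟ (λ i' → ∑ (λ j' → h i' j' when b j')) i)

  total-when-column : (j : Fin N) (b : Fin M → Bool) →
    total (λ i' j' → h i' j' when (b i' ∧ does (j' ≟F j))) ≡ ∑ (λ i' → h i' j when b i')
  total-when-column j b = ∑-cong (λ i' → trans (∑-when-∧ (h i') (b i') (λ j' → does (j' ≟F j)))
                                               (cong (_when b i') (∑-when-≟ (h i') j)))

  total-when-point : (i : Fin M) (j : Fin N) →
    total (λ i' j' → h i' j' when (does (i' ≟F i) ∧ does (j' ≟F j))) ≡ h i j
  total-when-point i j = trans (total-when-row i (λ j' → does (j' ≟F j))) (∑-when-≟ (h i) j)

_≡ᵇjust_ : ∀ {N} → Maybe (Fin N) → Fin N → Bool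
just k  ≡ᵇjust j = does (k ≟F j)
nothing ≡ᵇjust j = false

map-suc-≡ᵇjust : ∀ {N} (o : Maybe (Fin N)) k → (Maybe.map suc o ≡ᵇjust suc k) ≡ (o ≡ᵇjust k)
map-suc-≡ᵇjust (just _) k = refl
map-suc-≡ᵇjust nothing  k = refl

is-nothing-map : ∀ {A B : Set} (f : A → B) (o : Maybe A) → is-nothing (Maybe.map f o) ≡ is-nothing o
is-nothing-map f (just _) = refl
is-nothing-map f nothing  = refl

next-≢just-zero : ∀ {N} (j : Fin (suc N)) → (next j ≡ᵇjust zero) ≡ false
next-≢just-zero {zero}  zero = refl
next-≢just-zero {suc N} zero = refl
next-≢just-zero {suc N} (suc j) with next j
... | just _  = refl
... | nothing = refl

next-≡just-suc : ∀ {N} (j : Fin (suc N)) (k : Fin N) → (next j ≡ᵇjust suc k) ≡ does (j ≟F inject₁ k)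
next-≡just-suc {suc N} zero    zero    = refl
next-≡just-suc {suc N} zero    (suc k) = refl
next-≡just-suc {suc N} (suc j) zero    = trans (map-suc-≡ᵇjust (next j) zero) (next-≢just-zero j)
next-≡just-suc {suc N} (suc j) (suc k) = trans (map-suc-≡ᵇjust (next j) (suc k)) (next-≡just-suc j k)

next-is-nothing : ∀ {N} (j : Fin (suc N)) → is-nothing (next j) ≡ does (j ≟F fromℕ N)
next-is-nothing {zero}  zero    = refl
next-is-nothing {suc N} zero    = refl
next-is-nothing {suc N} (suc j) = trans (is-nothing-map suc (next j)) (next-is-nothing j)

-- 0 at the first index, where v¹_{i,1} (resp. v²_{1,j}) has no a¹-arc leaving (resp. a²-arc entering).
previous : ∀ {N} → (Fin N → ℤ) → Fin N → ℤ
previous h zero    = 0ℤ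
previous h (suc k) = h (inject₁ k)

∑-when-next≡just : ∀ {N} (h : Fin N → ℤ) (j : Fin N) →
                   ∑ (λ k → h k when (next k ≡ᵇjust j)) ≡ previous h j
∑-when-next≡just h zero    = ∑-when-false h next-≢just-zero
∑-when-next≡just h (suc j) = trans (∑-cong (λ k → cong (h k when_) (next-≡just-suc k j)))
                                   (∑-when-≟ h (inject₁ j))

∑-when-next-is-nothing : ∀ {N} (h : Fin (suc N) → ℤ) →
                         ∑ (λ k → h k when is-nothing (next k)) ≡ h (fromℕ N)
∑-when-next-is-nothing {N} h = trans (∑-cong (λ k → cong (h k when_) (next-is-nothing k)))
                                     (∑-when-≟ h (fromℕ N))

∑≤ : ∀ {N} → (Fin N → ℤ) → ℕ → ℤ
∑≤ h t = ∑ (λ k → h k when (toℕ k ≤ᵇℕ t))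

prefix : ∀ {N} → (Fin N → ℤ) → Fin N → ℤ
prefix h j = ∑≤ h (toℕ j)

suc≤ᵇsuc : ∀ k t → (suc k ≤ᵇℕ suc t) ≡ (k ≤ᵇℕ t)
suc≤ᵇsuc zero    t = refl
suc≤ᵇsuc (suc k) t = refl

∑≤-zero : ∀ {N} (h : Fin (suc N) → ℤ) → ∑≤ h 0 ≡ h zero
∑≤-zero {N} h = trans (cong (h zero +_) (∑-zero N)) (+-identityʳ _)

∑≤-suc : ∀ {N} (h : Fin (suc N) → ℤ) t → ∑≤ h (suc t) ≡ h zero + ∑≤ (λ k → h (suc k)) t
∑≤-suc h t = cong (h zero +_) (∑-cong (λ k → cong (h (suc k) when_) (suc≤ᵇsuc (toℕ k) t)))

∑≤-step : ∀ {N} (h : Fin (suc N) → ℤ) (k : Fin N) → ∑≤ h (suc (toℕ k)) ≡ ∑≤ h (toℕ k) + h (suc k)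
∑≤-step h zero = begin
  ∑≤ h 1                              ≡⟨ ∑≤-suc h 0 ⟩
  h zero + ∑≤ (λ k → h (suc k)) 0     ≡⟨ cong (h zero +_) (∑≤-zero (λ k → h (suc k))) ⟩
  h zero + h (suc zero)               ≡⟨ cong (_+ h (suc zero)) (∑≤-zero h) ⟨
  ∑≤ h 0 + h (suc zero)               ∎
  where open ≡-Reasoning
∑≤-step h (suc k) = begin
  ∑≤ h (suc (suc t))                              ≡⟨ ∑≤-suc h (suc t) ⟩
  h zero + ∑≤ h′ (suc t)                          ≡⟨ cong (h zero +_) (∑≤-step h′ k) ⟩
  h zero + (∑≤ h′ t + h (suc (suc k)))            ≡⟨ +-assoc (h zero) _ _ ⟨
  (h zero + ∑≤ h′ t) + h (suc (suc k))            ≡⟨ cong (_+ h (suc (suc k))) (∑≤-suc h t) ⟨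
  ∑≤ h (suc t) + h (suc (suc k))                  ∎
  where
  open ≡-Reasoning
  t = toℕ k
  h′ = λ k → h (suc k)

prefix-recurrence : ∀ {N} (h : Fin N → ℤ) j → prefix h j ≡ previous (prefix h) j + h j
prefix-recurrence h zero    = trans (∑≤-zero h) (sym (+-identityˡ _))
prefix-recurrence h (suc k) = trans (∑≤-step h k) (cong (λ t → ∑≤ h t + h (suc k)) (sym (toℕ-inject₁ k)))

recurrence⇒prefix : ∀ {N} {y h : Fin N → ℤ} → (∀ j → y j ≡ previous y j + h j) → ∀ j → y j ≡ prefix h j
recurrence⇒prefix {zero}          rec ()
recurrence⇒prefix {suc N} {y} {h} rec = <-weakInduction (λ j → y j ≡ prefix h j)
  (trans (rec zero) (sym (prefix-recurrence h zero)))
  (λ k ih → trans (rec (suc k)) (trans (cong (_+ h (suc k)) ih) (sym (prefix-recurrence h (suc k)))))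

prefix-last : ∀ {N} (h : Fin (suc N) → ℤ) → prefix h (fromℕ N) ≡ ∑ h
prefix-last {zero}  h = refl
prefix-last {suc N} h = trans (∑≤-suc h (toℕ (fromℕ N))) (cong (h zero +_) (prefix-last (λ k → h (suc k))))

module _ {m n : ℕ} (i' : Fin m) (j' : Fin n) where

  head-a²≟v¹ : ∀ i j → (head (a² i' j') ≟V v¹ i j) ≡ false
  head-a²≟v¹ i j with next i'
  ... | just _  = refl
  ... | nothing = refl

  head-a²≟v² : ∀ i j → (head (a² i' j') ≟V v² i j) ≡ (next i' ≡ᵇjust i) ∧ does (j' ≟F j)
  head-a²≟v² i j with next i'
  ... | just _  = refl
  ... | nothing = refl

  head-a²≟v¹₀ : (head (a² i' j') ≟V v¹₀) ≡ false
  head-a²≟v¹₀ with next i'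
  ... | just _  = refl
  ... | nothing = refl

  head-a²≟v²₀ : (head (a² i' j') ≟V v²₀) ≡ is-nothing (next i')
  head-a²≟v²₀ with next i'
  ... | just _  = refl
  ... | nothing = refl

  tail-a¹≟v¹ : ∀ i j → (tail (a¹ i' j') ≟V v¹ i j) ≡ does (i' ≟F i) ∧ (next j' ≡ᵇjust j)
  tail-a¹≟v¹ i j with next j'
  ... | just _  = refl
  ... | nothing = sym (∧-zeroʳ (does (i' ≟F i)))

  tail-a¹≟v² : ∀ i j → (tail (a¹ i' j') ≟V v² i j) ≡ false
  tail-a¹≟v² i j with next j'
  ... | just _  = refl
  ... | nothing = refl

  tail-a¹≟v¹₀ : (tail (a¹ i' j') ≟V v¹₀) ≡ is-nothing (next j')
  tail-a¹≟v¹₀ with next j'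
  ... | just _  = refl
  ... | nothing = refl

  tail-a¹≟v²₀ : (tail (a¹ i' j') ≟V v²₀) ≡ false
  tail-a¹≟v²₀ with next j'
  ... | just _  = refl
  ... | nothing = refl

module _ {m n : ℕ} (z : Arc m n → ℤ) (v : Vertex m n) {x y w : ℤ} where

  inflow-blocks :
    total (λ i j → z (a¹ i j) when (head (a¹ i j) ≟V v)) ≡ x →
    total (λ i j → z (a² i j) when (head (a² i j) ≟V v)) ≡ y →
    total (λ i j → z (a i j) when (head (a i j) ≟V v)) ≡ w →
    inflow z v ≡ x + y + w + z a₀ when (head a₀ ≟V v)
  inflow-blocks refl refl refl = refl

  outflow-blocks :
    total (λ i j → z (a¹ i j) when (tail (a¹ i j) ≟V v)) ≡ x →
    total (λ i j → z (a² i j) when (tail (a² i j) ≟V v)) ≡ y →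
    total (λ i j → z (a i j) when (tail (a i j) ≟V v)) ≡ w →
    outflow z v ≡ x + y + w + z a₀ when (tail a₀ ≟V v)
  outflow-blocks refl refl refl = refl

module _ {m n : ℕ} (z : Arc m n → ℤ) where

  private
    z¹ z² zₐ : Fin m → Fin n → ℤ
    z¹ i j = z (a¹ i j)
    z² i j = z (a² i j)
    zₐ i j = z (a i j)

  inflow-v¹ : ∀ i j → inflow z (v¹ i j) ≡ z (a¹ i j)
  inflow-v¹ i j = trans
    (inflow-blocks z (v¹ i j) (total-when-point z¹ i j)
                 (total-when-false z² (λ i' j' → head-a²≟v¹ i' j' i j))
                 (total-when-false zₐ (λ _ _ → refl)))
    (trans (+-identityʳ _) (trans (+-identityʳ _) (+-identityʳ _)))

  outflow-v¹ : ∀ i j → outflow z (v¹ i j) ≡ previous (z¹ i) j + z (a i j)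
  outflow-v¹ i j = trans
    (outflow-blocks z (v¹ i j) (trans (total-when-cong z¹ (λ i' j' → tail-a¹≟v¹ i' j' i j))
                        (trans (total-when-row z¹ i (λ j' → next j' ≡ᵇjust j))
                               (∑-when-next≡just (z¹ i) j)))
                 (total-when-false z² (λ _ _ → refl))
                 (total-when-point zₐ i j))
    (trans (+-identityʳ _) (cong (_+ z (a i j)) (+-identityʳ (previous (z¹ i) j))))

  inflow-v² : ∀ i j → inflow z (v² i j) ≡ previous (λ i' → z² i' j) i + z (a i j)
  inflow-v² i j = trans
    (inflow-blocks z (v² i j) (total-when-false z¹ (λ _ _ → refl))
                 (trans (total-when-cong z² (λ i' j' → head-a²≟v² i' j' i j))
                        (trans (total-when-column z² j (λ i' → next i' ≡ᵇjust i))
                               (∑-when-next≡just (λ i' → z² i' j) i)))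
                 (total-when-point zₐ i j))
    (trans (+-identityʳ _) (cong (_+ z (a i j)) (+-identityˡ (previous (λ i' → z² i' j) i))))

  outflow-v² : ∀ i j → outflow z (v² i j) ≡ z (a² i j)
  outflow-v² i j = trans
    (outflow-blocks z (v² i j) (total-when-false z¹ (λ i' j' → tail-a¹≟v² i' j' i j))
                 (total-when-point z² i j)
                 (total-when-false zₐ (λ _ _ → refl)))
    (trans (+-identityʳ _) (trans (+-identityʳ _) (+-identityˡ _)))

  inflow-v¹₀ : inflow z v¹₀ ≡ z a₀
  inflow-v¹₀ = trans
    (inflow-blocks z v¹₀ (total-when-false z¹ (λ _ _ → refl))
                 (total-when-false z² head-a²≟v¹₀)
                 (total-when-false zₐ (λ _ _ → refl)))
    (+-identityˡ _)

  outflow-v²₀ : outflow z v²₀ ≡ z a₀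
  outflow-v²₀ = trans
    (outflow-blocks z v²₀ (total-when-false z¹ tail-a¹≟v²₀)
                 (total-when-false z² (λ _ _ → refl))
                 (total-when-false zₐ (λ _ _ → refl)))
    (+-identityˡ _)

outflow-v¹₀ : ∀ {m n} (z : Arc m (suc n) → ℤ) → outflow z v¹₀ ≡ ∑ (λ i → z (a¹ i (fromℕ n)))
outflow-v¹₀ z = trans
  (outflow-blocks z v¹₀ (trans (total-when-cong (λ i j → z (a¹ i j)) tail-a¹≟v¹₀)
                      (∑-cong (λ i → ∑-when-next-is-nothing (λ j → z (a¹ i j)))))
               (total-when-false (λ i j → z (a² i j)) (λ _ _ → refl))
               (total-when-false (λ i j → z (a i j)) (λ _ _ → refl)))
  (trans (+-identityʳ _) (trans (+-identityʳ _) (+-identityʳ _)))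

inflow-v²₀ : ∀ {m n} (z : Arc (suc m) n → ℤ) → inflow z v²₀ ≡ ∑ (λ j → z (a² (fromℕ m) j))
inflow-v²₀ z = trans
  (inflow-blocks z v²₀ (total-when-false (λ i j → z (a¹ i j)) (λ _ _ → refl))
               (trans (total-when-cong (λ i j → z (a² i j)) head-a²≟v²₀)
                      (trans (∑-cong (λ i → ∑-when-const (λ j → z (a² i j)) (is-nothing (next i))))
                             (∑-when-next-is-nothing (λ i → ∑ (λ j → z (a² i j))))))
               (total-when-false (λ i j → z (a i j)) (λ _ _ → refl)))
  (trans (+-identityʳ _) (trans (+-identityʳ _) (+-identityˡ _)))

module _ {m n : ℕ} (z : Arc m n → ℤ) (circ : IsCirculation z) where

  circulation⇒row-prefix : ∀ i j → z (a¹ i j) ≡ rowPrefix (matrixOf z) i j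
  circulation⇒row-prefix i = recurrence⇒prefix {y = λ j → z (a¹ i j)} {h = matrixOf z i}
    (λ j → trans (sym (inflow-v¹ z i j)) (trans (circ (v¹ i j)) (outflow-v¹ z i j)))

  circulation⇒column-prefix : ∀ i j → z (a² i j) ≡ colPrefix (matrixOf z) i j
  circulation⇒column-prefix i j = recurrence⇒prefix {y = λ i' → z (a² i' j)} {h = λ i' → matrixOf z i' j}
    (λ i' → trans (sym (outflow-v² z i' j)) (trans (sym (circ (v² i' j))) (inflow-v² z i' j))) i

circulation⇒a₀≡total : ∀ {m n} (z : Arc m (suc n) → ℤ) → IsCirculation z → z a₀ ≡ total (matrixOf z)
circulation⇒a₀≡total {n = n} z circ = begin
  z a₀                          ≡⟨ inflow-v¹₀ z ⟨
  inflow z v¹₀                  ≡⟨ circ v¹₀ ⟩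
  outflow z v¹₀                 ≡⟨ outflow-v¹₀ z ⟩
  ∑ (λ i → z (a¹ i (fromℕ n)))  ≡⟨ ∑-cong (λ i → trans (circulation⇒row-prefix z circ i (fromℕ n))
                                                        (prefix-last (matrixOf z i))) ⟩
  total (matrixOf z)            ∎
  where open ≡-Reasoning

circOf-isCirculation : ∀ {m n} (M : Fin (suc m) → Fin (suc n) → ℤ) → IsCirculation (circOf M)
circOf-isCirculation M (v¹ i j) =
  trans (inflow-v¹ (circOf M) i j) (trans (prefix-recurrence (M i) j) (sym (outflow-v¹ (circOf M) i j)))
circOf-isCirculation M (v² i j) =
  trans (inflow-v² (circOf M) i j)
        (trans (sym (prefix-recurrence (λ k → M k j) i)) (sym (outflow-v² (circOf M) i j)))
circOf-isCirculation M v¹₀ =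
  trans (inflow-v¹₀ (circOf M)) (sym (trans (outflow-v¹₀ (circOf M)) (∑-cong (λ i → prefix-last (M i)))))
circOf-isCirculation M v²₀ = begin
  inflow (circOf M) v²₀                       ≡⟨ inflow-v²₀ (circOf M) ⟩
  ∑ (λ j → colPrefix M (fromℕ _) j)           ≡⟨ ∑-cong (λ j → prefix-last (λ i → M i j)) ⟩
  ∑ (λ j → ∑ (λ i → M i j))                   ≡⟨ ∑-swap M ⟨
  total M                                     ≡⟨ outflow-v²₀ (circOf M) ⟨
  outflow (circOf M) v²₀                      ∎
  where open ≡-Reasoning

module _ {m n : ℕ} (Φ¹ Γ¹ Φ² Γ² f g : Fin (suc m) → Fin (suc n) → ℤ∞) (α β : ℤ∞) where

  bounded-circulation⇒matrix : (z : Arc (suc m) (suc n) → ℤ) → IsCirculation z →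
    (∀ e → lower Φ¹ Φ² f α e ≤∞ fin (z e)) → (∀ e → fin (z e) ≤∞ upper Γ¹ Γ² g β e) →
    PrefixBounded Φ¹ Γ¹ Φ² Γ² (matrixOf z)
    × (∀ i j → (f i j ≤∞ fin (matrixOf z i j)) × (fin (matrixOf z i j) ≤∞ g i j))
    × (α ≤∞ fin (total (matrixOf z))) × (fin (total (matrixOf z)) ≤∞ β)
  bounded-circulation⇒matrix z circ lo up =
    prefixBounded , (λ i j → lo (a i j) , up (a i j)) ,
    subst (α ≤∞_) (cong fin a₀≡total) (lo a₀) , subst (_≤∞ β) (cong fin a₀≡total) (up a₀)
    where
    a₀≡total : z a₀ ≡ total (matrixOf z)
    a₀≡total = circulation⇒a₀≡total z circ

    prefixBounded : PrefixBounded Φ¹ Γ¹ Φ² Γ² (matrixOf z)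
    prefixBounded i j
      rewrite sym (circulation⇒row-prefix z circ i j) | sym (circulation⇒column-prefix z circ i j) =
      lo (a¹ i j) , up (a¹ i j) , lo (a² i j) , up (a² i j)

  bounded-matrix⇒circulation : (M : Fin (suc m) → Fin (suc n) → ℤ) → PrefixBounded Φ¹ Γ¹ Φ² Γ² M →
    (∀ i j → (f i j ≤∞ fin (M i j)) × (fin (M i j) ≤∞ g i j)) →
    (α ≤∞ fin (total M)) → (fin (total M) ≤∞ β) →
    IsCirculation (circOf M)
    × (∀ e → lower Φ¹ Φ² f α e ≤∞ fin (circOf M e))
    × (∀ e → fin (circOf M e) ≤∞ upper Γ¹ Γ² g β e)
  bounded-matrix⇒circulation M prefixBounded entries α≤total total≤β = circOf-isCirculation M , lo , up
    where
    lo : ∀ e → lower Φ¹ Φ² f α e ≤∞ fin (circOf M e)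
    lo (a¹ i j) = proj₁ (prefixBounded i j)
    lo (a² i j) = proj₁ (proj₂ (proj₂ (prefixBounded i j)))
    lo (a i j)  = proj₁ (entries i j)
    lo a₀       = α≤total

    up : ∀ e → fin (circOf M e) ≤∞ upper Γ¹ Γ² g β e
    up (a¹ i j) = proj₁ (proj₂ (prefixBounded i j))
    up (a² i j) = proj₂ (proj₂ (proj₂ (prefixBounded i j)))
    up (a i j)  = proj₂ (entries i j)
    up a₀       = total≤β

-- The hypotheses on Φ, Γ, f, g, α, β only make the bounds meaningful; the correspondence does not use them.
theorem7p2 : (m n : ℕ) → m ≥ 1 → n ≥ 1 →
    (Φ¹ Γ¹ Φ² Γ² f g : Fin m → Fin n → ℤ∞) → (α β : ℤ∞) →
    (∀ i j → Φ¹ i j ≢ +∞) → (∀ i j → Φ² i j ≢ +∞) → (∀ i j → f i j ≢ +∞) →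
    (∀ i j → Γ¹ i j ≢ -∞) → (∀ i j → Γ² i j ≢ -∞) → (∀ i j → g i j ≢ -∞) →
    (∀ i j → Φ¹ i j ≤∞ Γ¹ i j) → (∀ i j → Φ² i j ≤∞ Γ² i j) →
    (∀ i j → f i j ≤∞ g i j) → α ≤∞ β →
    ((z : Arc m n → ℤ) → IsCirculation z →
      (∀ e → lower Φ¹ Φ² f α e ≤∞ fin (z e)) → (∀ e → fin (z e) ≤∞ upper Γ¹ Γ² g β e) →
      PrefixBounded Φ¹ Γ¹ Φ² Γ² (matrixOf z)
      × (∀ i j → (f i j ≤∞ fin (matrixOf z i j)) × (fin (matrixOf z i j) ≤∞ g i j))
      × (α ≤∞ fin (total (matrixOf z))) × (fin (total (matrixOf z)) ≤∞ β))
    ×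
    ((M : Fin m → Fin n → ℤ) → PrefixBounded Φ¹ Γ¹ Φ² Γ² M →
      (∀ i j → (f i j ≤∞ fin (M i j)) × (fin (M i j) ≤∞ g i j)) →
      (α ≤∞ fin (total M)) → (fin (total M) ≤∞ β) →
      IsCirculation (circOf M)
      × (∀ e → lower Φ¹ Φ² f α e ≤∞ fin (circOf M e))
      × (∀ e → fin (circOf M e) ≤∞ upper Γ¹ Γ² g β e))
theorem7p2 zero    _       () _
theorem7p2 (suc m) zero    _  ()
theorem7p2 (suc m) (suc n) _  _ Φ¹ Γ¹ Φ² Γ² f g α β _ _ _ _ _ _ _ _ _ _ =
  bounded-circulation⇒matrix Φ¹ Γ¹ Φ² Γ² f g α β , bounded-matrix⇒circulation Φ¹ Γ¹ Φ² Γ² f g α β
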